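{- Let $G$ be a graph and $U\subseteq V(G)$ a set of vertices such that for each edge $\{x,y\}$ of the induced subgraph $G[U]$ there is a vertex $v\in V(G)\setminus U$ whose open neighborhood is exactly $N_G(v)=\{x,y\}$. Then there is a minimum-size dominating set $S$ of $G$ such that $S$ is a vertex cover of $G[U]$ (i.e., every edge of $G[U]$ has at least one endpoint in $S$).
   Context: All graphs are finite, simple and undirected. $N_G(v)$ denotes the set of neighbors of $v$ in $G$. A dominating set of $G$ is a set $S\subseteq V(G)$ such that every vertex of $G$ is in $S$ or has a neighbor in $S$. $G[U]$ is the subgraph induced by $U$. -}

module Defs where

open import Data.Nat using (ℕ; _≤_)
open import Data.Fin using (Fin)
open import Data.Fin.Subset using (Subset; _∈_; _∉_; ∣_∣)
open import Data.Product using (Σ; ∃; _×_; _,_)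
open import Data.Sum using (_⊎_)
open import Relation.Nullary using (¬_; Dec)
open import Relation.Binary.PropositionalEquality using (_≡_)

record Graph (n : ℕ) : Set₁ where
  field
    Adj     : Fin n → Fin n → Set
    adj?    : ∀ x y → Dec (Adj x y)
    sym     : ∀ {x y} → Adj x y → Adj y x
    irrefl  : ∀ {x} → ¬ Adj x x

open Graph public

IsDominating : ∀ {n} → Graph n → Subset n → Set
IsDominating G S = ∀ v → v ∈ S ⊎ ∃ λ u → Adj G v u × u ∈ S

IsMinDominating : ∀ {n} → Graph n → Subset n → Set
IsMinDominating G S = IsDominating G S × (∀ T → IsDominating G T → ∣ S ∣ ≤ ∣ T ∣)

NbhdIsPair : ∀ {n} → Graph n → Fin n → Fin n → Fin n → Set
NbhdIsPair G v x y = ∀ u → (Adj G v u → u ≡ x ⊎ u ≡ y) × (u ≡ x ⊎ u ≡ y → Adj G v u)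

PendantPairCondition : ∀ {n} → Graph n → Subset n → Set
PendantPairCondition G U =
  ∀ x y → x ∈ U → y ∈ U → Adj G x y → ∃ λ v → v ∉ U × NbhdIsPair G v x y

IsVertexCoverOfInduced : ∀ {n} → Graph n → Subset n → Subset n → Set
IsVertexCoverOfInduced G U S =
  ∀ x y → x ∈ U → y ∈ U → Adj G x y → x ∈ S ⊎ y ∈ S

-- Among the minimum dominating sets choose one, S, with the fewest vertices outside U.
-- If an edge xy of G[U] had neither end in S, the vertex v with N(v) = {x, y} could only
-- be dominated by itself, so v ∈ S; exchanging v for x keeps S dominating (x dominates
-- v and y, and every vertex dominated by v is x or y) without increasing its size, but
-- trades the vertex v ∉ U for x ∈ U, contradicting the choice of S.
module Submission where

open import Defs
open import Data.Nat using (ℕ; suc; _+_; _≤_; _<_; s≤s; _<?_; _≤?_)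
open import Data.Nat.Properties
  using (≤-refl; ≤-trans; ≮⇒≥; <⇒≱; n≤1+n; +-monoʳ-≤; +-suc; ≤-reflexive; module ≤-Reasoning)
open import Data.Nat.Induction using (<-rec)
open import Data.Fin using (Fin; _≟_)
open import Data.Fin.Subset using (Subset; _∈_; _∉_; _⊆_; ∣_∣; inside; outside; _∪_; _─_; _-_; ⁅_⁆; ⊤)
open import Data.Fin.Subset.Properties
  using ( _∈?_; anySubset?; ∈⊤; p⊆q⇒∣p∣≤∣q∣; x∈⁅x⁆; x∈⁅y⁆⇒x≡y; x∉⁅y⁆⇒x≢y; ∣⁅x⁆∣≡1
        ; x∈p∪q⁺; x∈p∪q⁻; p─q⊆p; x∈p∧x∉q⇒x∈p─q; x∈p∧x≢y⇒x∈p-y; x∈p⇒∣p-x∣<∣p∣ )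
open import Data.Fin.Properties using (any?; all?)
open import Data.Vec using (_∷_; []; here; there)
open import Data.Product using (∃; _×_; _,_; proj₁; proj₂)
open import Data.Sum using (inj₁; inj₂)
open import Relation.Nullary using (yes; no; contradiction)
open import Relation.Nullary.Decidable using (_×-dec_; _⊎-dec_)
open import Relation.Unary using (Decidable)
open import Relation.Binary.PropositionalEquality using (_≡_; _≢_; refl; subst; cong) renaming (sym to ≡-sym)

private
  variable
    n : ℕ

x∈p─q⇒x∉q : ∀ {x : Fin n} {p q : Subset n} → x ∈ p ─ q → x ∉ q
x∈p─q⇒x∉q {p = _ ∷ p} {outside ∷ q} here      ()
x∈p─q⇒x∉q {p = _ ∷ p} {_       ∷ q} (there m) (there x∈q) = x∈p─q⇒x∉q m x∈q

∣p∪q∣≤∣p∣+∣q∣ : ∀ (p q : Subset n) → ∣ p ∪ q ∣ ≤ ∣ p ∣ + ∣ q ∣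
∣p∪q∣≤∣p∣+∣q∣ []            []            = ≤-refl
∣p∪q∣≤∣p∣+∣q∣ (inside  ∷ p) (inside  ∷ q) =
  s≤s (≤-trans (∣p∪q∣≤∣p∣+∣q∣ p q) (+-monoʳ-≤ ∣ p ∣ (n≤1+n ∣ q ∣)))
∣p∪q∣≤∣p∣+∣q∣ (inside  ∷ p) (outside ∷ q) =
  s≤s (∣p∪q∣≤∣p∣+∣q∣ p q)
∣p∪q∣≤∣p∣+∣q∣ (outside ∷ p) (inside  ∷ q) =
  ≤-trans (s≤s (∣p∪q∣≤∣p∣+∣q∣ p q)) (≤-reflexive (≡-sym (+-suc ∣ p ∣ ∣ q ∣)))
∣p∪q∣≤∣p∣+∣q∣ (outside ∷ p) (outside ∷ q) =
  ∣p∪q∣≤∣p∣+∣q∣ p q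

∣⁅y⁆∪p-x∣≤∣p∣ : ∀ {x : Fin n} {p} y → x ∈ p → ∣ ⁅ y ⁆ ∪ (p - x) ∣ ≤ ∣ p ∣
∣⁅y⁆∪p-x∣≤∣p∣ {x = x} {p} y x∈p = begin
  ∣ ⁅ y ⁆ ∪ (p - x) ∣        ≤⟨ ∣p∪q∣≤∣p∣+∣q∣ ⁅ y ⁆ (p - x) ⟩
  ∣ ⁅ y ⁆ ∣ + ∣ p - x ∣      ≡⟨ cong (_+ ∣ p - x ∣) (∣⁅x⁆∣≡1 y) ⟩
  suc ∣ p - x ∣              ≤⟨ x∈p⇒∣p-x∣<∣p∣ x∈p ⟩
  ∣ p ∣                      ∎
  where open ≤-Reasoning

⁅y⁆∪p-x─q⊆p─q-x : ∀ {x y : Fin n} {p q} → y ∈ q → (⁅ y ⁆ ∪ (p - x)) ─ q ⊆ (p ─ q) - x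
⁅y⁆∪p-x─q⊆p─q-x {y = y} {p} {q} y∈q {z} z∈ with x∈p∪q⁻ ⁅ y ⁆ _ (p─q⊆p _ q z∈)
... | inj₁ z∈⁅y⁆ = contradiction (subst (_∈ q) (≡-sym (x∈⁅y⁆⇒x≡y y z∈⁅y⁆)) y∈q) (x∈p─q⇒x∉q z∈)
... | inj₂ z∈p-x = x∈p∧x≢y⇒x∈p-y
  (x∈p∧x∉q⇒x∈p─q (p─q⊆p p _ z∈p-x) (x∈p─q⇒x∉q z∈))
  (x∉⁅y⁆⇒x≢y (x∈p─q⇒x∉q z∈p-x))

∣⁅y⁆∪p-x─q∣<∣p─q∣ : ∀ {x y : Fin n} {p q} → x ∈ p → x ∉ q → y ∈ q →
                    ∣ (⁅ y ⁆ ∪ (p - x)) ─ q ∣ < ∣ p ─ q ∣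
∣⁅y⁆∪p-x─q∣<∣p─q∣ {x = x} {y} {p} {q} x∈p x∉q y∈q = begin-strict
  ∣ (⁅ y ⁆ ∪ (p - x)) ─ q ∣   ≤⟨ p⊆q⇒∣p∣≤∣q∣ {p = (⁅ y ⁆ ∪ (p - x)) ─ q} (⁅y⁆∪p-x─q⊆p─q-x {p = p} y∈q) ⟩
  ∣ (p ─ q) - x ∣             <⟨ x∈p⇒∣p-x∣<∣p∣ (x∈p∧x∉q⇒x∈p─q x∈p x∉q) ⟩
  ∣ p ─ q ∣                   ∎
  where open ≤-Reasoning

x∈⁅x⁆∪p : ∀ {x : Fin n} {p} → x ∈ ⁅ x ⁆ ∪ p
x∈⁅x⁆∪p {x = x} = x∈p∪q⁺ (inj₁ (x∈⁅x⁆ x))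

x∈p∧x≢y⇒x∈⁅z⁆∪p-y : ∀ {x y z : Fin n} {p} → x ∈ p → x ≢ y → x ∈ ⁅ z ⁆ ∪ (p - y)
x∈p∧x≢y⇒x∈⁅z⁆∪p-y x∈p x≢y = x∈p∪q⁺ (inj₂ (x∈p∧x≢y⇒x∈p-y x∈p x≢y))

Minimises : (Subset n → Set) → (Subset n → ℕ) → Subset n → Set
Minimises P f S = P S × (∀ T → P T → f S ≤ f T)

argmin : (P : Subset n → Set) → Decidable P → (f : Subset n → ℕ) → ∃ P → ∃ (Minimises P f)
argmin P P? f (T₀ , pT₀) = <-rec Goal descend (f T₀) T₀ refl pT₀
  where
  Goal : ℕ → Set
  Goal k = ∀ T → f T ≡ k → P T → ∃ (Minimises P f)

  descend : ∀ k → (∀ {j} → j < k → Goal j) → Goal k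
  descend _ smaller T refl pT with anySubset? (λ T′ → P? T′ ×-dec (f T′ <? f T))
  ... | yes (T′ , pT′ , fT′<fT) = smaller fT′<fT T′ refl pT′
  ... | no noSmaller = T , pT , λ T′ pT′ → ≮⇒≥ (λ fT′<fT → noSmaller (T′ , pT′ , fT′<fT))

module _ (G : Graph n) where

  isDominating? : Decidable (IsDominating G)
  isDominating? S = all? (λ v → (v ∈? S) ⊎-dec any? (λ u → adj? G v u ×-dec (u ∈? S)))

  ⊤-isDominating : IsDominating G ⊤
  ⊤-isDominating v = inj₁ ∈⊤

  module _ {S : Subset n} {v x y : Fin n} (dom : IsDominating G S) (N[v]≡xy : NbhdIsPair G v x y) where

    pendant∈dominating : x ∉ S → y ∉ S → v ∈ S
    pendant∈dominating x∉S y∉S with dom v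
    ... | inj₁ v∈S = v∈S
    ... | inj₂ (u , v~u , u∈S) with proj₁ (N[v]≡xy u) v~u
    ... | inj₁ refl = contradiction u∈S x∉S
    ... | inj₂ refl = contradiction u∈S y∉S

    swap-isDominating : Adj G x y → IsDominating G (⁅ x ⁆ ∪ (S - v))
    swap-isDominating x~y w with w ≟ v
    ... | yes refl = inj₂ (x , proj₂ (N[v]≡xy x) (inj₁ refl) , x∈⁅x⁆∪p)
    ... | no w≢v with dom w
    ... | inj₁ w∈S = inj₁ (x∈p∧x≢y⇒x∈⁅z⁆∪p-y w∈S w≢v)
    ... | inj₂ (u , w~u , u∈S) with u ≟ v
    ... | no u≢v = inj₂ (u , w~u , x∈p∧x≢y⇒x∈⁅z⁆∪p-y u∈S u≢v)
    ... | yes refl with proj₁ (N[v]≡xy w) (Graph.sym G w~u)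
    ... | inj₁ refl = inj₁ (x∈⁅x⁆∪p)
    ... | inj₂ refl = inj₂ (x , Graph.sym G x~y , x∈⁅x⁆∪p)

  fewestOutside-isVertexCover : ∀ {U S} → PendantPairCondition G U → IsDominating G S →
    (∀ T → IsDominating G T → ∣ T ∣ ≤ ∣ S ∣ → ∣ S ─ U ∣ ≤ ∣ T ─ U ∣) →
    IsVertexCoverOfInduced G U S
  fewestOutside-isVertexCover {U} {S} pendant dom fewest x y x∈U y∈U x~y with x ∈? S | y ∈? S
  ... | yes x∈S | _       = inj₁ x∈S
  ... | no _    | yes y∈S = inj₂ y∈S
  ... | no x∉S  | no y∉S  with pendant x y x∈U y∈U x~y
  ... | v , v∉U , N[v]≡xy = contradiction (fewest S′ S′-dom S′-small) (<⇒≱ S′-fewer)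
    where
    v∈S : v ∈ S
    v∈S = pendant∈dominating dom N[v]≡xy x∉S y∉S

    S′ : Subset n
    S′ = ⁅ x ⁆ ∪ (S - v)

    S′-dom : IsDominating G S′
    S′-dom = swap-isDominating dom N[v]≡xy x~y

    S′-small : ∣ S′ ∣ ≤ ∣ S ∣
    S′-small = ∣⁅y⁆∪p-x∣≤∣p∣ x v∈S

    S′-fewer : ∣ S′ ─ U ∣ < ∣ S ─ U ∣
    S′-fewer = ∣⁅y⁆∪p-x─q∣<∣p─q∣ v∈S v∉U x∈U

proposition10 : ∀ {n} (G : Graph n) (U : Subset n) →
    PendantPairCondition G U →
    ∃ λ S → IsMinDominating G S × IsVertexCoverOfInduced G U S
proposition10 G U pendant
  with argmin (IsDominating G) (isDominating? G) ∣_∣ (⊤ , ⊤-isDominating G)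
... | S₀ , S₀-dom , S₀-min
  with argmin (λ T → IsDominating G T × ∣ T ∣ ≤ ∣ S₀ ∣)
              (λ T → isDominating? G T ×-dec (∣ T ∣ ≤? ∣ S₀ ∣))
              (λ T → ∣ T ─ U ∣)
              (S₀ , S₀-dom , ≤-refl)
... | S , (S-dom , S≤S₀) , S-fewest =
  S , (S-dom , λ T T-dom → ≤-trans S≤S₀ (S₀-min T T-dom)) ,
  fewestOutside-isVertexCover G pendant S-dom
    (λ T T-dom T≤S → S-fewest T (T-dom , ≤-trans T≤S S≤S₀))
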